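{- Let $G$ be a finite simple graph, let $\{x,y\}\subseteq V(G)$ be a determining set of $G$, and let $d_1,d_2\in V(G)\setminus\{x,y\}$ be distinct vertices such that some automorphism of $G$ swaps $x$ and $y$ and swaps $d_1$ and $d_2$. If some automorphism of $G$ swaps $x$ and $d_1$ and fixes $y$, then no automorphism of $G$ swaps $y$ and $d_1$ and fixes $x$.
   Context: A set $S\subseteq V(G)$ is a determining set if the only automorphism of $G$ fixing every vertex of $S$ is the identity. -}

module Defs where

open import Data.Nat using (ℕ)
open import Data.Fin using (Fin)
open import Data.Product using (_×_)
open import Relation.Binary.PropositionalEquality using (_≡_)
open import Relation.Nullary using (¬_)
open import Function.Bundles using (_↔_; Inverse)
open import Data.Sum using (_⊎_)

record Graph (n : ℕ) : Set₁ where
  field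
    Adj   : Fin n → Fin n → Set
    sym   : ∀ {u v} → Adj u v → Adj v u
    irrfl : ∀ {u} → ¬ Adj u u

open Graph public

record Automorphism {n : ℕ} (G : Graph n) : Set where
  field
    perm     : Fin n ↔ Fin n
    preserve : ∀ u v → Adj G u v → Adj G (Inverse.to perm u) (Inverse.to perm v)
    reflect  : ∀ u v → Adj G (Inverse.to perm u) (Inverse.to perm v) → Adj G u v

  ap : Fin n → Fin n
  ap = Inverse.to perm

open Automorphism public

IsDeterminingSet : {n : ℕ} (G : Graph n) (S : Fin n → Set) → Set
IsDeterminingSet {n} G S =
  (σ : Automorphism G) → (∀ v → S v → ap σ v ≡ v) → ∀ v → ap σ v ≡ v

Pair : {n : ℕ} → Fin n → Fin n → Fin n → Set
Pair x y v = (v ≡ x) ⊎ (v ≡ y)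

{-# OPTIONS --safe #-}
module Submission where

-- With σ swapping x, y and d₁, d₂, τ = (x d₁) and ρ = (y d₁) on these points,
-- the conjugate α = τ ρ τ swaps x and y and fixes d₁. Then σ α fixes the
-- determining set {x, y}, so it is the identity; but it sends d₁ to d₂ ≠ d₁.

open import Defs
open import Data.Nat using (ℕ)
open import Data.Fin using (Fin)
open import Data.Product using (_×_; Σ-syntax; _,_; proj₁; proj₂)
open import Data.Sum using (inj₁; inj₂)
open import Function using (_∘_)
open import Function.Construct.Composition using (_↔-∘_)
open import Relation.Binary.PropositionalEquality
  using (_≡_; _≢_; refl; cong; module ≡-Reasoning)
open import Relation.Nullary using (¬_)

Swaps : {A : Set} → (A → A) → A → A → Set
Swaps f a b = f a ≡ b × f b ≡ a

-- On the points a, b, c this is the identity (a b)(b c)(a b) = (a c).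
conjugate-swaps : {A : Set} (f g : A → A) {a b c : A} →
  Swaps f a b → f c ≡ c → Swaps g b c → g a ≡ a →
  Swaps (f ∘ g ∘ f) a c × f (g (f b)) ≡ b
conjugate-swaps f g {a} {b} {c} (fa , fb) fc (gb , gc) ga =
  ( (begin f (g (f a)) ≡⟨ cong (f ∘ g) fa ⟩ f (g b) ≡⟨ cong f gb ⟩ f c ≡⟨ fc ⟩ c ∎)
    , (begin f (g (f c)) ≡⟨ cong (f ∘ g) fc ⟩ f (g c) ≡⟨ cong f gc ⟩ f b ≡⟨ fb ⟩ a ∎) )
  , (begin f (g (f b)) ≡⟨ cong (f ∘ g) fb ⟩ f (g a) ≡⟨ cong f ga ⟩ f a ≡⟨ fa ⟩ b ∎)
  where open ≡-Reasoning

infixr 9 _∘ᴬ_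

_∘ᴬ_ : {n : ℕ} {G : Graph n} → Automorphism G → Automorphism G → Automorphism G
σ ∘ᴬ τ = record
  { perm     = perm σ ↔-∘ perm τ
  ; preserve = λ u v → preserve σ (ap τ u) (ap τ v) ∘ preserve τ u v
  ; reflect  = λ u v → reflect τ u v ∘ reflect σ (ap τ u) (ap τ v)
  }

swaps-pair⇒inverse : {n : ℕ} {G : Graph n} {x y : Fin n} →
  IsDeterminingSet G (Pair x y) → (σ α : Automorphism G) →
  Swaps (ap σ) x y → Swaps (ap α) x y → ∀ v → ap σ (ap α v) ≡ v
swaps-pair⇒inverse det σ α (σx , σy) (αx , αy) = det (σ ∘ᴬ α) fixes-pair
  where
  open ≡-Reasoning
  fixes-pair : ∀ v → Pair _ _ v → ap σ (ap α v) ≡ v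
  fixes-pair v (inj₁ refl) = begin ap σ (ap α v) ≡⟨ cong (ap σ) αx ⟩ ap σ _ ≡⟨ σy ⟩ v ∎
  fixes-pair v (inj₂ refl) = begin ap σ (ap α v) ≡⟨ cong (ap σ) αy ⟩ ap σ _ ≡⟨ σx ⟩ v ∎

proposition7 : {n : ℕ} (G : Graph n) (x y d₁ d₂ : Fin n) →
    IsDeterminingSet G (Pair x y) →
    d₁ ≢ x → d₁ ≢ y → d₂ ≢ x → d₂ ≢ y → d₁ ≢ d₂ →
    (Σ[ σ ∈ Automorphism G ]
      (ap σ x ≡ y × ap σ y ≡ x × ap σ d₁ ≡ d₂ × ap σ d₂ ≡ d₁)) →
    (Σ[ τ ∈ Automorphism G ] (ap τ x ≡ d₁ × ap τ d₁ ≡ x × ap τ y ≡ y)) →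
    ¬ (Σ[ ρ ∈ Automorphism G ] (ap ρ y ≡ d₁ × ap ρ d₁ ≡ y × ap ρ x ≡ x))
proposition7 G x y d₁ d₂ det _ _ _ _ d₁≢d₂
  (σ , σx , σy , σd₁ , _) (τ , τx , τd₁ , τy) (ρ , ρy , ρd₁ , ρx) =
  d₁≢d₂ (begin
    d₁                   ≡⟨ swaps-pair⇒inverse det σ α (σx , σy) α-swaps d₁ ⟨
    ap σ (ap α d₁)       ≡⟨ cong (ap σ) α-fixes-d₁ ⟩
    ap σ d₁              ≡⟨ σd₁ ⟩
    d₂                   ∎)
  where
  open ≡-Reasoning
  α : Automorphism _
  α = τ ∘ᴬ ρ ∘ᴬ τ
  α-on-x-y-d₁ : Swaps (ap α) x y × ap α d₁ ≡ d₁
  α-on-x-y-d₁ = conjugate-swaps (ap τ) (ap ρ) (τx , τd₁) τy (ρd₁ , ρy) ρx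
  α-swaps : Swaps (ap α) x y
  α-swaps = proj₁ α-on-x-y-d₁
  α-fixes-d₁ : ap α d₁ ≡ d₁
  α-fixes-d₁ = proj₂ α-on-x-y-d₁
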